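{- Let $W=W(x,y,z)=\sum_{n,k,m\ge0}w_{n,k,m}x^ny^kz^m$ as a formal power series. Then \[(x-x^2y+x^2yz)W^2-(1+x-xy)W+1=0.\]
   Context: A Dyck path of semilength $n$ is a word in the letters $U,D$ with $n$ copies of each letter such that no prefix contains more $D$'s than $U$'s. A $UD$-factor (resp. $UUD$-factor) is an occurrence of $UD$ (resp. $UUD$) as a consecutive subword. $w_{n,k,m}$ denotes the number of Dyck paths of semilength $n$ with exactly $k$ $UD$-factors and exactly $m$ $UUD$-factors. -}

module Defs where

open import Data.Nat as ℕ using (ℕ; zero; suc; _≤_; _∸_)
open import Data.Nat.Properties using (_≤?_) renaming (_≟_ to _≟ℕ_)
open import Data.Integer as ℤ using (ℤ; +_)
open import Data.List using (List; []; _∷_; length; filter; concatMap; inits; tails; sum; map)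
open import Data.List.Relation.Unary.All using (All; all?)
open import Data.Product using (_×_; _,_)
open import Relation.Nullary using (Dec; yes; no; ¬_)
open import Relation.Nullary.Decidable using (_×-dec_)
open import Relation.Binary.PropositionalEquality using (_≡_; refl)

data Step : Set where
  U D : Step

_≟S_ : (a b : Step) → Dec (a ≡ b)
U ≟S U = yes refl
U ≟S D = no (λ ())
D ≟S U = no (λ ())
D ≟S D = yes refl

count : Step → List Step → ℕ
count s [] = 0
count s (t ∷ w) with s ≟S t
... | yes _ = suc (count s w)
... | no  _ = count s w

words : ℕ → List (List Step)
words zero    = [] ∷ []
words (suc l) = concatMap (λ w → (U ∷ w) ∷ (D ∷ w) ∷ []) (words l)

IsDyck : ℕ → List Step → Set
IsDyck n w = count U w ≡ n × count D w ≡ n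
           × All (λ p → count D p ≤ count U p) (inits w)

isDyck? : ∀ n w → Dec (IsDyck n w)
isDyck? n w = (count U w ≟ℕ n) ×-dec ((count D w ≟ℕ n)
              ×-dec all? (λ p → count D p ≤? count U p) (inits w))

isPrefix : List Step → List Step → Set
isPrefix [] w = Data.Unit.⊤ where import Data.Unit
isPrefix (a ∷ p) [] = Data.Empty.⊥ where import Data.Empty
isPrefix (a ∷ p) (b ∷ w) = a ≡ b × isPrefix p w

isPrefix? : ∀ p w → Dec (isPrefix p w)
isPrefix? [] w = yes Data.Unit.tt where import Data.Unit
isPrefix? (a ∷ p) [] = no (λ ())
isPrefix? (a ∷ p) (b ∷ w) = (a ≟S b) ×-dec isPrefix? p w

factors : List Step → List Step → ℕ
factors p w = length (filter (isPrefix? p) (tails w))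

wnkm : ℕ → ℕ → ℕ → ℕ
wnkm n k m = length (filter
  (λ w → isDyck? n w ×-dec ((factors (U ∷ D ∷ []) w ≟ℕ k)
                   ×-dec (factors (U ∷ U ∷ D ∷ []) w ≟ℕ m)))
  (words (n ℕ.+ n)))

-- Formal power series in x, y, z over ℤ, as coefficient functions:
-- f n k m is the coefficient of x^n y^k z^m.

Series : Set
Series = ℕ → ℕ → ℕ → ℤ

Σ≤ : ℕ → (ℕ → ℤ) → ℤ
Σ≤ zero    f = f 0
Σ≤ (suc n) f = Σ≤ n f ℤ.+ f (suc n)

_⊕_ : Series → Series → Series
(f ⊕ g) n k m = f n k m ℤ.+ g n k m

⊝_ : Series → Series
(⊝ f) n k m = ℤ.- f n k m

_⊖_ : Series → Series → Series
f ⊖ g = f ⊕ (⊝ g)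

_⊛_ : Series → Series → Series
(f ⊛ g) n k m = Σ≤ n λ a → Σ≤ k λ b → Σ≤ m λ c →
  f a b c ℤ.* g (n ∸ a) (k ∸ b) (m ∸ c)

mono : ℕ → ℕ → ℕ → Series
mono a b c n k m with a ≟ℕ n | b ≟ℕ k | c ≟ℕ m
... | yes _ | yes _ | yes _ = + 1
... | _     | _     | _     = + 0

𝟘 𝟙 : Series
𝟘 n k m = + 0
𝟙 = mono 0 0 0

infixl 6 _⊕_ _⊖_
infixl 7 _⊛_
infix 8 ⊝_

W : Series
W n k m = + wnkm n k m

-- A nonempty Dyck path factors uniquely as U P D Q with P and Q Dyck paths (its first return).
-- Its UD-factors are those of P and of Q, plus one when P is empty; its UUD-factors are those of P
-- and of Q, plus one when P begins with a peak U D. Hence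
--   W = 1 + x W² − x W + x y W − x² y W² + x² y z W²,
-- where x W² counts the pairs (P , Q) with the uncorrected statistics, and the terms in x W, x y W
-- (P empty) and in x² y W², x² y z W² (P = U D P′) trade that count for the corrected one. At the
-- coefficient of xᴺ⁺¹ every term becomes a sum over the same pairs, and the six contributions of
-- each pair cancel.

module Submission where

open import Defs
open import Data.Bool using (Bool; true; false; T; not; _∧_)
open import Data.List using (List; []; _∷_; _++_; length; null)
open import Data.Product using (_×_; _,_; ∃; proj₁; proj₂)
open import Relation.Binary.PropositionalEquality
open import Relation.Nullary using (Dec; does; yes; no)

module Paths where

  open import Data.List using (inits; replicate)
  open import Data.List.Properties using (++-assoc)
  open import Data.List.Relation.Unary.All using (All; []; _∷_)
  open import Data.List.Relation.Unary.All.Properties using (gmap⁺; gmap⁻)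
  open import Data.Nat using (ℕ; zero; suc; _+_; _≤_; _≡ᵇ_; z≤n; s≤s)
  open import Data.Nat.Properties using (+-suc; +-assoc; +-identityʳ; suc-injective; ≡ᵇ⇒≡)
  open import Data.Product using (map; map₁)
  open import Relation.Nullary.Decidable using (map′; T?; does-≡)

  dyckFrom : ℕ → List Step → Bool
  dyckFrom h       []      = h ≡ᵇ 0
  dyckFrom h       (U ∷ w) = dyckFrom (suc h) w
  dyckFrom zero    (D ∷ w) = false
  dyckFrom (suc h) (D ∷ w) = dyckFrom h w

  IsDyckFrom : ℕ → List Step → Set
  IsDyckFrom h w = All (λ p → count D p ≤ h + count U p) (inits w) × count D w ≡ h + count U w

  IsDyckFrom⇒dyckFrom : ∀ h w → IsDyckFrom h w → T (dyckFrom h w)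
  IsDyckFrom⇒dyckFrom zero    []      (_ , refl) = _
  IsDyckFrom⇒dyckFrom (suc h) []      (_ , ())
  IsDyckFrom⇒dyckFrom h       (U ∷ w) (_ ∷ bounded , ends) =
    IsDyckFrom⇒dyckFrom (suc h) w
      ( gmap⁻ (λ {p} → subst (count D p ≤_) (+-suc h (count U p))) bounded
      , trans ends (+-suc h (count U w)))
  IsDyckFrom⇒dyckFrom zero    (D ∷ w) (_ ∷ () ∷ _ , _)
  IsDyckFrom⇒dyckFrom (suc h) (D ∷ w) (_ ∷ bounded , ends) =
    IsDyckFrom⇒dyckFrom h w (gmap⁻ (λ { (s≤s le) → le }) bounded , suc-injective ends)

  dyckFrom⇒IsDyckFrom : ∀ h w → T (dyckFrom h w) → IsDyckFrom h w
  dyckFrom⇒IsDyckFrom h []      t rewrite ≡ᵇ⇒≡ h 0 t = z≤n ∷ [] , refl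
  dyckFrom⇒IsDyckFrom h (U ∷ w) t with dyckFrom⇒IsDyckFrom (suc h) w t
  ... | bounded , ends =
    z≤n ∷ gmap⁺ (λ {p} → subst (count D p ≤_) (sym (+-suc h (count U p)))) bounded
    , trans ends (sym (+-suc h (count U w)))
  dyckFrom⇒IsDyckFrom (suc h) (D ∷ w) t with dyckFrom⇒IsDyckFrom h w t
  ... | bounded , ends = z≤n ∷ gmap⁺ s≤s bounded , cong suc ends

  count-length : ∀ w → count U w + count D w ≡ length w
  count-length []      = refl
  count-length (U ∷ w) = cong suc (count-length w)
  count-length (D ∷ w) = trans (+-suc (count U w) (count D w)) (cong suc (count-length w))

  isDyck?≡dyckFrom : ∀ n w → length w ≡ n + n → does (isDyck? n w) ≡ dyckFrom 0 w
  isDyck?≡dyckFrom n w len = does-≡ (isDyck? n w) (map′ fromDyckFrom toDyckFrom (T? (dyckFrom 0 w)))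
    where
    double-injective : ∀ a b → a + a ≡ b + b → a ≡ b
    double-injective zero    zero    _ = refl
    double-injective (suc a) (suc b) e rewrite +-suc a a | +-suc b b =
      cong suc (double-injective a b (suc-injective (suc-injective e)))

    fromDyckFrom : T (dyckFrom 0 w) → IsDyck n w
    fromDyckFrom t with dyckFrom⇒IsDyckFrom 0 w t
    ... | bounded , ends = countU , trans ends countU , bounded
      where
      countU : count U w ≡ n
      countU = double-injective _ _ (trans (cong (count U w +_) (sym ends)) (trans (count-length w) len))

    toDyckFrom : IsDyck n w → T (dyckFrom 0 w)
    toDyckFrom (countU , countD , bounded) = IsDyckFrom⇒dyckFrom 0 w (bounded , trans countD (sym countU))

  ud uud : List Step → ℕ
  ud  = factors (U ∷ D ∷ [])
  uud = factors (U ∷ U ∷ D ∷ [])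

  ud₂ uud₂ : List Step → List Step → ℕ
  ud₂  P Q = ud P + ud Q
  uud₂ P Q = uud P + uud Q

  ups : ℕ → List Step
  ups j = replicate j U ++ D ∷ []

  χ : Bool → ℕ
  χ true  = 1
  χ false = 0

  factors-∷ : ∀ p c w → factors p (c ∷ w) ≡ χ (does (isPrefix? p (c ∷ w))) + factors p w
  factors-∷ p c w with does (isPrefix? p (c ∷ w))
  ... | true  = refl
  ... | false = refl

  isPrefix?-ups-++ : ∀ j x y →
    does (isPrefix? (ups j) (x ++ D ∷ y)) ≡ does (isPrefix? (ups j) (x ++ D ∷ []))
  isPrefix?-ups-++ zero    []      y = refl
  isPrefix?-ups-++ zero    (c ∷ x) y = refl
  isPrefix?-ups-++ (suc j) []      y = refl
  isPrefix?-ups-++ (suc j) (c ∷ x) y = cong (does (U ≟S c) ∧_) (isPrefix?-ups-++ j x y)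

  -- An occurrence of U^j D cannot straddle a D.
  factors-ups-++ : ∀ j x y → factors (ups j) (x ++ D ∷ y) ≡ factors (ups j) (x ++ D ∷ []) + factors (ups j) y
  factors-ups-++ zero    []      y = refl
  factors-ups-++ (suc j) []      y = refl
  factors-ups-++ j (c ∷ x) y = begin
    factors (ups j) (c ∷ x ++ D ∷ y)
      ≡⟨ factors-∷ (ups j) c (x ++ D ∷ y) ⟩
    χ (does (isPrefix? (ups j) (c ∷ x ++ D ∷ y))) + factors (ups j) (x ++ D ∷ y)
      ≡⟨ cong₂ (λ b n → χ b + n) (isPrefix?-ups-++ j (c ∷ x) y) (factors-ups-++ j x y) ⟩
    χ (does (isPrefix? (ups j) (c ∷ x ++ D ∷ []))) + (factors (ups j) (x ++ D ∷ []) + factors (ups j) y)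
      ≡⟨ sym (+-assoc (χ (does (isPrefix? (ups j) (c ∷ x ++ D ∷ [])))) _ _) ⟩
    χ (does (isPrefix? (ups j) (c ∷ x ++ D ∷ []))) + factors (ups j) (x ++ D ∷ []) + factors (ups j) y
      ≡⟨ cong (_+ factors (ups j) y) (sym (factors-∷ (ups j) c (x ++ D ∷ []))) ⟩
    factors (ups j) (c ∷ x ++ D ∷ []) + factors (ups j) y
      ∎
    where open ≡-Reasoning

  dyckFrom-endsWithD : ∀ h c w → T (dyckFrom h (c ∷ w)) → ∃ λ w′ → c ∷ w ≡ w′ ++ D ∷ []
  dyckFrom-endsWithD (suc h) D []      t = [] , refl
  dyckFrom-endsWithD h       U (c ∷ w) t = map (U ∷_) (cong (U ∷_)) (dyckFrom-endsWithD (suc h) c w t)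
  dyckFrom-endsWithD (suc h) D (c ∷ w) t = map (D ∷_) (cong (D ∷_)) (dyckFrom-endsWithD h c w t)

  factors-ups-snocD : ∀ j w → (∃ λ w′ → w ≡ w′ ++ D ∷ []) →
    factors (ups (suc j)) (w ++ D ∷ []) ≡ factors (ups (suc j)) w
  factors-ups-snocD j _ (w′ , refl) = begin
    factors (ups (suc j)) ((w′ ++ D ∷ []) ++ D ∷ [])
      ≡⟨ cong (factors (ups (suc j))) (++-assoc w′ (D ∷ []) (D ∷ [])) ⟩
    factors (ups (suc j)) (w′ ++ D ∷ D ∷ [])
      ≡⟨ factors-ups-++ (suc j) w′ (D ∷ []) ⟩
    factors (ups (suc j)) (w′ ++ D ∷ []) + 0
      ≡⟨ +-identityʳ _ ⟩
    factors (ups (suc j)) (w′ ++ D ∷ [])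
      ∎
    where open ≡-Reasoning

  -- For v read from height h + 1, firstReturn h v = (P , Q) with v = P ++ D ∷ Q, where this D is
  -- the first step of v down to height 0.
  firstReturn : ℕ → List Step → List Step × List Step
  firstReturn h       []      = [] , []
  firstReturn h       (U ∷ v) = map₁ (U ∷_) (firstReturn (suc h) v)
  firstReturn zero    (D ∷ v) = [] , v
  firstReturn (suc h) (D ∷ v) = map₁ (D ∷_) (firstReturn h v)

  firstReturn-++ : ∀ h v → T (dyckFrom (suc h) v) →
    v ≡ proj₁ (firstReturn h v) ++ D ∷ proj₂ (firstReturn h v)
  firstReturn-++ h       (U ∷ v) t = cong (U ∷_) (firstReturn-++ (suc h) v t)
  firstReturn-++ zero    (D ∷ v) t = refl
  firstReturn-++ (suc h) (D ∷ v) t = cong (D ∷_) (firstReturn-++ h v t)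

  firstReturn-dyckFrom : ∀ h v → T (dyckFrom (suc h) v) → T (dyckFrom h (proj₁ (firstReturn h v)))
  firstReturn-dyckFrom h       (U ∷ v) t = firstReturn-dyckFrom (suc h) v t
  firstReturn-dyckFrom zero    (D ∷ v) t = _
  firstReturn-dyckFrom (suc h) (D ∷ v) t = firstReturn-dyckFrom h v t

  startsWithPeak : List Step → Bool
  startsWithPeak (U ∷ D ∷ _) = true
  startsWithPeak _           = false

  ¬null∧startsWithPeak : ∀ P → T (not (null P ∧ startsWithPeak P))
  ¬null∧startsWithPeak []      = _
  ¬null∧startsWithPeak (_ ∷ _) = _

  ud-U∷-snocD : ∀ P → T (dyckFrom 0 P) → ud (U ∷ P ++ D ∷ []) ≡ χ (null P) + ud P
  ud-U∷-snocD []      t = refl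
  ud-U∷-snocD (U ∷ P) t =
    factors-ups-snocD 0 (U ∷ U ∷ P) (map (U ∷_) (cong (U ∷_)) (dyckFrom-endsWithD 0 U P t))

  uud-U∷-snocD : ∀ P → T (dyckFrom 0 P) → uud (U ∷ P ++ D ∷ []) ≡ χ (startsWithPeak P) + uud P
  uud-U∷-snocD []      t = refl
  uud-U∷-snocD (U ∷ P) t = begin
    uud (U ∷ U ∷ P ++ D ∷ [])
      ≡⟨ factors-ups-snocD 1 (U ∷ U ∷ P) (map (U ∷_) (cong (U ∷_)) (dyckFrom-endsWithD 0 U P t)) ⟩
    uud (U ∷ U ∷ P)
      ≡⟨ uud-UU P ⟩
    χ (startsWithPeak (U ∷ P)) + uud (U ∷ P)
      ∎
    where
    open ≡-Reasoning
    uud-UU : ∀ P → uud (U ∷ U ∷ P) ≡ χ (startsWithPeak (U ∷ P)) + uud (U ∷ P)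
    uud-UU []      = refl
    uud-UU (U ∷ _) = refl
    uud-UU (D ∷ _) = refl

  ud-firstReturn : ∀ P Q → T (dyckFrom 0 P) → ud (U ∷ P ++ D ∷ Q) ≡ χ (null P) + ud₂ P Q
  ud-firstReturn P Q t = begin
    ud (U ∷ P ++ D ∷ Q)                ≡⟨ factors-ups-++ 1 (U ∷ P) Q ⟩
    ud (U ∷ P ++ D ∷ []) + ud Q        ≡⟨ cong (_+ ud Q) (ud-U∷-snocD P t) ⟩
    χ (null P) + ud P + ud Q           ≡⟨ +-assoc (χ (null P)) (ud P) (ud Q) ⟩
    χ (null P) + ud₂ P Q               ∎
    where open ≡-Reasoning

  uud-firstReturn : ∀ P Q → T (dyckFrom 0 P) → uud (U ∷ P ++ D ∷ Q) ≡ χ (startsWithPeak P) + uud₂ P Q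
  uud-firstReturn P Q t = begin
    uud (U ∷ P ++ D ∷ Q)                     ≡⟨ factors-ups-++ 2 (U ∷ P) Q ⟩
    uud (U ∷ P ++ D ∷ []) + uud Q            ≡⟨ cong (_+ uud Q) (uud-U∷-snocD P t) ⟩
    χ (startsWithPeak P) + uud P + uud Q     ≡⟨ +-assoc (χ (startsWithPeak P)) (uud P) (uud Q) ⟩
    χ (startsWithPeak P) + uud₂ P Q          ∎
    where open ≡-Reasoning

  dyckFrom-even : ∀ h w → T (dyckFrom h w) → ∃ λ d → length w + h ≡ d + d
  dyckFrom-even h       []      t = 0 , ≡ᵇ⇒≡ h 0 t
  dyckFrom-even h       (U ∷ w) t with dyckFrom-even (suc h) w t
  ... | d , e = d , trans (sym (+-suc (length w) h)) e
  dyckFrom-even (suc h) (D ∷ w) t with dyckFrom-even h w t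
  ... | d , e = suc d , cong suc (trans (+-suc (length w) h) (trans (cong suc e) (sym (+-suc d d))))

open Paths

open import Data.Empty using (⊥-elim)
open import Data.List using (filter; concatMap)
open import Data.Nat as ℕ using (ℕ; zero; suc; _∸_; _≡ᵇ_)
import Data.Nat.Properties as ℕ
open import Data.Product using (uncurry)
open import Relation.Nullary.Decidable using (_×-dec_)
open import Data.Integer using (ℤ; +_; 0ℤ; 1ℤ; _+_; _*_; -_; _-_)
open import Data.Integer.Properties
open import Data.Integer.Tactic.RingSolver using (solve-∀)
open import Algebra.Properties.CommutativeSemigroup +-commutativeSemigroup
  using () renaming (interchange to +-interchange)

ind : Bool → ℤ
ind true  = 1ℤ
ind false = 0ℤ

guard : Bool → ℤ → ℤ
guard true  x = x
guard false _ = 0ℤ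

guard-zero : ∀ b → guard b 0ℤ ≡ 0ℤ
guard-zero true  = refl
guard-zero false = refl

guard-+ : ∀ b x y → guard b (x + y) ≡ guard b x + guard b y
guard-+ true  x y = refl
guard-+ false x y = refl

guard-neg : ∀ b x → guard b (- x) ≡ - guard b x
guard-neg true  x = refl
guard-neg false x = refl

guard-* : ∀ a b x y → guard a x * guard b y ≡ guard a (guard b (x * y))
guard-* false b     x y = refl
guard-* true  false x y = *-zeroʳ x
guard-* true  true  x y = refl

ind-≡ᵇ-refl : ∀ a → ind (a ≡ᵇ a) ≡ 1ℤ
ind-≡ᵇ-refl zero    = refl
ind-≡ᵇ-refl (suc a) = ind-≡ᵇ-refl a

ind-≡ᵇ-≢ : ∀ {a i} → a ≢ i → ind (a ≡ᵇ i) ≡ 0ℤ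
ind-≡ᵇ-≢ {a} {i} a≢i with a ≡ᵇ i in eq
... | true  = ⊥-elim (a≢i (ℕ.≡ᵇ⇒≡ a i (subst T (sym eq) _)))
... | false = refl

ind-∧ : ∀ a b c → ind (a ∧ (b ∧ c)) ≡ guard a (ind b * ind c)
ind-∧ false b     c     = refl
ind-∧ true  false c     = refl
ind-∧ true  true  false = refl
ind-∧ true  true  true  = refl

Σ≤-cong : ∀ n {f g : ℕ → ℤ} → (∀ i → f i ≡ g i) → Σ≤ n f ≡ Σ≤ n g
Σ≤-cong zero    e = e 0
Σ≤-cong (suc n) e = cong₂ _+_ (Σ≤-cong n e) (e (suc n))

Σ≤-zero : ∀ n {f : ℕ → ℤ} → (∀ i → f i ≡ 0ℤ) → Σ≤ n f ≡ 0ℤ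
Σ≤-zero zero    e = e 0
Σ≤-zero (suc n) e rewrite Σ≤-zero n e | e (suc n) = refl

Σ≤-+ : ∀ n (f g : ℕ → ℤ) → Σ≤ n (λ i → f i + g i) ≡ Σ≤ n f + Σ≤ n g
Σ≤-+ zero    f g = refl
Σ≤-+ (suc n) f g rewrite Σ≤-+ n f g = +-interchange (Σ≤ n f) (Σ≤ n g) (f (suc n)) (g (suc n))

Σ≤-neg : ∀ n (f : ℕ → ℤ) → Σ≤ n (λ i → - f i) ≡ - Σ≤ n f
Σ≤-neg zero    f = refl
Σ≤-neg (suc n) f rewrite Σ≤-neg n f = sym (neg-distrib-+ (Σ≤ n f) (f (suc n)))

Σ≤-*ˡ : ∀ n c (f : ℕ → ℤ) → Σ≤ n (λ i → c * f i) ≡ c * Σ≤ n f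
Σ≤-*ˡ zero    c f = refl
Σ≤-*ˡ (suc n) c f rewrite Σ≤-*ˡ n c f = sym (*-distribˡ-+ c (Σ≤ n f) (f (suc n)))

Σ≤-guard : ∀ n b (f : ℕ → ℤ) → Σ≤ n (λ i → guard b (f i)) ≡ guard b (Σ≤ n f)
Σ≤-guard n true  f = refl
Σ≤-guard n false f = Σ≤-zero n (λ _ → refl)

Σ≤-suc : ∀ n (f : ℕ → ℤ) → Σ≤ (suc n) f ≡ f 0 + Σ≤ n (λ i → f (suc i))
Σ≤-suc zero    f = refl
Σ≤-suc (suc n) f rewrite Σ≤-suc n f = +-assoc (f 0) _ _

Σ≤-even : ∀ n (f : ℕ → ℤ) → (∀ a → f (suc (a ℕ.+ a)) ≡ 0ℤ) → Σ≤ (n ℕ.+ n) f ≡ Σ≤ n (λ a → f (a ℕ.+ a))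
Σ≤-even zero    f odd = refl
Σ≤-even (suc n) f odd = begin
  Σ≤ (suc n ℕ.+ suc n) f
    ≡⟨ cong (λ l → Σ≤ (suc l) f) (ℕ.+-suc n n) ⟩
  Σ≤ (n ℕ.+ n) f + f (suc (n ℕ.+ n)) + f (suc (suc (n ℕ.+ n)))
    ≡⟨ cong₂ (λ x y → x + y + f (suc (suc (n ℕ.+ n)))) (Σ≤-even n f odd) (odd n) ⟩
  Σ≤ n (λ a → f (a ℕ.+ a)) + 0ℤ + f (suc (suc (n ℕ.+ n)))
    ≡⟨ cong₂ _+_ (+-identityʳ (Σ≤ n (λ a → f (a ℕ.+ a)))) (cong (λ l → f (suc l)) (sym (ℕ.+-suc n n))) ⟩
  Σ≤ n (λ a → f (a ℕ.+ a)) + f (suc n ℕ.+ suc n)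
    ∎
  where open ≡-Reasoning

-- shift a f n is the coefficient of tⁿ in tᵃ · Σ f i tⁱ.
shift : ℕ → (ℕ → ℤ) → ℕ → ℤ
shift zero    f n       = f n
shift (suc a) f zero    = 0ℤ
shift (suc a) f (suc n) = shift a f n

Σ≤-δ : ∀ a n (f : ℕ → ℤ) → Σ≤ n (λ i → ind (a ≡ᵇ i) * f (n ∸ i)) ≡ shift a f n
Σ≤-δ zero    zero    f = *-identityˡ (f 0)
Σ≤-δ zero    (suc n) f = begin
  Σ≤ (suc n) (λ i → ind (0 ≡ᵇ i) * f (suc n ∸ i))  ≡⟨ Σ≤-suc n _ ⟩
  1ℤ * f (suc n) + Σ≤ n (λ _ → 0ℤ)
    ≡⟨ cong₂ _+_ (*-identityˡ (f (suc n))) (Σ≤-zero n (λ _ → refl)) ⟩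
  f (suc n) + 0ℤ                                  ≡⟨ +-identityʳ (f (suc n)) ⟩
  f (suc n)                                       ∎
  where open ≡-Reasoning
Σ≤-δ (suc a) zero    f = refl
Σ≤-δ (suc a) (suc n) f = begin
  Σ≤ (suc n) (λ i → ind (suc a ≡ᵇ i) * f (suc n ∸ i))  ≡⟨ Σ≤-suc n _ ⟩
  0ℤ + Σ≤ n (λ i → ind (a ≡ᵇ i) * f (n ∸ i))           ≡⟨ +-identityˡ _ ⟩
  Σ≤ n (λ i → ind (a ≡ᵇ i) * f (n ∸ i))                ≡⟨ Σ≤-δ a n f ⟩
  shift a f n                                          ∎
  where open ≡-Reasoning

shift-ind : ∀ a b n x → shift a (λ i → ind (b ≡ᵇ i) * x) n ≡ ind (a ℕ.+ b ≡ᵇ n) * x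
shift-ind zero    b n       x = refl
shift-ind (suc a) b zero    x = refl
shift-ind (suc a) b (suc n) x = shift-ind a b n x

Σ≤-ind-convolution : ∀ n a b x → Σ≤ n (λ i → ind (a ≡ᵇ i) * (ind (b ≡ᵇ n ∸ i) * x)) ≡ ind (a ℕ.+ b ≡ᵇ n) * x
Σ≤-ind-convolution n a b x = trans (Σ≤-δ a n (λ j → ind (b ≡ᵇ j) * x)) (shift-ind a b n x)

Σ³ : ℕ → ℕ → ℕ → (ℕ → ℕ → ℕ → ℤ) → ℤ
Σ³ n k m f = Σ≤ n λ a → Σ≤ k λ b → Σ≤ m λ c → f a b c

Σ³-cong : ∀ n k m {f g : ℕ → ℕ → ℕ → ℤ} → (∀ a b c → f a b c ≡ g a b c) → Σ³ n k m f ≡ Σ³ n k m g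
Σ³-cong n k m e = Σ≤-cong n λ a → Σ≤-cong k λ b → Σ≤-cong m λ c → e a b c

Σ³-+ : ∀ n k m (f g : ℕ → ℕ → ℕ → ℤ) → Σ³ n k m (λ a b c → f a b c + g a b c) ≡ Σ³ n k m f + Σ³ n k m g
Σ³-+ n k m f g =
  trans (Σ≤-cong n λ a → trans (Σ≤-cong k λ b → Σ≤-+ m (f a b) (g a b)) (Σ≤-+ k _ _)) (Σ≤-+ n _ _)

Σ³-neg : ∀ n k m (f : ℕ → ℕ → ℕ → ℤ) → Σ³ n k m (λ a b c → - f a b c) ≡ - Σ³ n k m f
Σ³-neg n k m f =
  trans (Σ≤-cong n λ a → trans (Σ≤-cong k λ b → Σ≤-neg m (f a b)) (Σ≤-neg k _)) (Σ≤-neg n _)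

⊛-distribʳ-⊕ : ∀ F G H n k m → ((F ⊕ G) ⊛ H) n k m ≡ (F ⊛ H) n k m + (G ⊛ H) n k m
⊛-distribʳ-⊕ F G H n k m =
  trans (Σ³-cong n k m λ a b c → *-distribʳ-+ (H (n ∸ a) (k ∸ b) (m ∸ c)) (F a b c) (G a b c))
        (Σ³-+ n k m _ _)

⊝-distribˡ-⊛ : ∀ F H n k m → ((⊝ F) ⊛ H) n k m ≡ - (F ⊛ H) n k m
⊝-distribˡ-⊛ F H n k m =
  trans (Σ³-cong n k m λ a b c → sym (neg-distribˡ-* (F a b c) (H (n ∸ a) (k ∸ b) (m ∸ c))))
        (Σ³-neg n k m _)

mono-ind : ∀ a b c i j l → mono a b c i j l ≡ ind (a ≡ᵇ i) * (ind (b ≡ᵇ j) * ind (c ≡ᵇ l))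
mono-ind a b c i j l with a ℕ.≟ i | b ℕ.≟ j | c ℕ.≟ l
... | no a≢i  | _        | _        rewrite ind-≡ᵇ-≢ a≢i = refl
... | yes refl | no b≢j  | _        rewrite ind-≡ᵇ-refl a | ind-≡ᵇ-≢ b≢j = refl
... | yes refl | yes refl | no c≢l  rewrite ind-≡ᵇ-refl a | ind-≡ᵇ-refl b | ind-≡ᵇ-≢ c≢l = refl
... | yes refl | yes refl | yes refl rewrite ind-≡ᵇ-refl a | ind-≡ᵇ-refl b | ind-≡ᵇ-refl c = refl

mono-⊛ : ∀ a b c F n k m →
  (mono a b c ⊛ F) n k m ≡ shift a (λ i → shift b (λ j → shift c (F i j) m) k) n
mono-⊛ a b c F n k m = begin
  (mono a b c ⊛ F) n k m
    ≡⟨ Σ³-cong n k m (λ i j l → trans (cong (_* F (n ∸ i) (k ∸ j) (m ∸ l)) (mono-ind a b c i j l))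
                                        (*-assoc³ (δa i) (δb j) (δc l) (F (n ∸ i) (k ∸ j) (m ∸ l)))) ⟩
  Σ³ n k m (λ i j l → δa i * (δb j * (δc l * F (n ∸ i) (k ∸ j) (m ∸ l))))
    ≡⟨ Σ≤-cong n (λ i → trans (Σ≤-cong k (λ j → Σ≤-*ˡ m (δa i) _)) (Σ≤-*ˡ k (δa i) _)) ⟩
  Σ≤ n (λ i → δa i * Σ≤ k (λ j → Σ≤ m (λ l → δb j * (δc l * F (n ∸ i) (k ∸ j) (m ∸ l)))))
    ≡⟨ Σ≤-cong n (λ i → cong (δa i *_) (Σ≤-cong k (λ j → trans (Σ≤-*ˡ m (δb j) _)
                                             (cong (δb j *_) (Σ≤-δ c m (F (n ∸ i) (k ∸ j))))))) ⟩
  Σ≤ n (λ i → δa i * Σ≤ k (λ j → δb j * shift c (F (n ∸ i) (k ∸ j)) m))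
    ≡⟨ Σ≤-cong n (λ i → cong (δa i *_) (Σ≤-δ b k (λ j → shift c (F (n ∸ i) j) m))) ⟩
  Σ≤ n (λ i → δa i * shift b (λ j → shift c (F (n ∸ i) j) m) k)
    ≡⟨ Σ≤-δ a n (λ i → shift b (λ j → shift c (F i j) m) k) ⟩
  shift a (λ i → shift b (λ j → shift c (F i j) m) k) n
    ∎
  where
  open ≡-Reasoning
  δa δb δc : ℕ → ℤ
  δa i = ind (a ≡ᵇ i)
  δb j = ind (b ≡ᵇ j)
  δc l = ind (c ≡ᵇ l)
  *-assoc³ : ∀ x y z w → x * (y * z) * w ≡ x * (y * (z * w))
  *-assoc³ = solve-∀

combine : ℤ → ℤ → ℤ → ℤ → ℤ → ℤ → ℤ
combine x₁ x₂ x₃ y₁ y₂ y₃ = x₁ - x₂ + x₃ - (y₁ + y₂ - y₃)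

combine-cong : ∀ {x₁ x₂ x₃ y₁ y₂ y₃ x₁′ x₂′ x₃′ y₁′ y₂′ y₃′} →
  x₁ ≡ x₁′ → x₂ ≡ x₂′ → x₃ ≡ x₃′ → y₁ ≡ y₁′ → y₂ ≡ y₂′ → y₃ ≡ y₃′ →
  combine x₁ x₂ x₃ y₁ y₂ y₃ ≡ combine x₁′ x₂′ x₃′ y₁′ y₂′ y₃′
combine-cong refl refl refl refl refl refl = refl

expand : ∀ F G n k m →
  ((mono 1 0 0 ⊖ mono 2 1 0 ⊕ mono 2 1 1) ⊛ F ⊖ (𝟙 ⊕ mono 1 0 0 ⊖ mono 1 1 0) ⊛ G ⊕ 𝟙) n k m
    ≡ combine ((mono 1 0 0 ⊛ F) n k m) ((mono 2 1 0 ⊛ F) n k m) ((mono 2 1 1 ⊛ F) n k m)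
              ((𝟙 ⊛ G) n k m) ((mono 1 0 0 ⊛ G) n k m) ((mono 1 1 0 ⊛ G) n k m) + 𝟙 n k m
expand F G n k m = cong (_+ 𝟙 n k m) (cong₂ _-_
  (trans (⊛-distribʳ-⊕ (mono 1 0 0 ⊖ mono 2 1 0) (mono 2 1 1) F n k m)
         (cong (_+ (mono 2 1 1 ⊛ F) n k m)
               (trans (⊛-distribʳ-⊕ (mono 1 0 0) (⊝ mono 2 1 0) F n k m)
                      (cong (_+_ ((mono 1 0 0 ⊛ F) n k m)) (⊝-distribˡ-⊛ (mono 2 1 0) F n k m)))))
  (trans (⊛-distribʳ-⊕ (𝟙 ⊕ mono 1 0 0) (⊝ mono 1 1 0) G n k m)
         (cong₂ _+_ (⊛-distribʳ-⊕ 𝟙 (mono 1 0 0) G n k m) (⊝-distribˡ-⊛ (mono 1 1 0) G n k m))))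

Σlist : {A : Set} → List A → (A → ℤ) → ℤ
Σlist []       f = 0ℤ
Σlist (x ∷ xs) f = f x + Σlist xs f

length-filter : ∀ {A : Set} {P : A → Set} (P? : ∀ x → Dec (P x)) xs →
  + length (filter P? xs) ≡ Σlist xs (λ x → ind (does (P? x)))
length-filter P? []       = refl
length-filter P? (x ∷ xs) with does (P? x)
... | true  = cong (_+_ 1ℤ) (length-filter P? xs)
... | false = trans (length-filter P? xs) (sym (+-identityˡ _))

Σword : ℕ → (List Step → ℤ) → ℤ
Σword zero    f = f []
Σword (suc L) f = Σword L (λ w → f (U ∷ w)) + Σword L (λ w → f (D ∷ w))

Σword-congL : ∀ L {f g : List Step → ℤ} → (∀ w → length w ≡ L → f w ≡ g w) → Σword L f ≡ Σword L g
Σword-congL zero    e = e [] refl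
Σword-congL (suc L) e = cong₂ _+_ (Σword-congL L λ w l → e (U ∷ w) (cong suc l))
                                  (Σword-congL L λ w l → e (D ∷ w) (cong suc l))

Σword-cong : ∀ L {f g : List Step → ℤ} → (∀ w → f w ≡ g w) → Σword L f ≡ Σword L g
Σword-cong L e = Σword-congL L (λ w _ → e w)

Σword-zero : ∀ L {f : List Step → ℤ} → (∀ w → f w ≡ 0ℤ) → Σword L f ≡ 0ℤ
Σword-zero zero    e = e []
Σword-zero (suc L) e rewrite Σword-zero L (λ w → e (U ∷ w)) | Σword-zero L (λ w → e (D ∷ w)) = refl

Σword-+ : ∀ L (f g : List Step → ℤ) → Σword L (λ w → f w + g w) ≡ Σword L f + Σword L g
Σword-+ zero    f g = refl
Σword-+ (suc L) f g
  rewrite Σword-+ L (λ w → f (U ∷ w)) (λ w → g (U ∷ w)) | Σword-+ L (λ w → f (D ∷ w)) (λ w → g (D ∷ w)) =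
  +-interchange (Σword L (λ w → f (U ∷ w))) (Σword L (λ w → g (U ∷ w)))
                (Σword L (λ w → f (D ∷ w))) (Σword L (λ w → g (D ∷ w)))

Σword-neg : ∀ L (f : List Step → ℤ) → Σword L (λ w → - f w) ≡ - Σword L f
Σword-neg zero    f = refl
Σword-neg (suc L) f rewrite Σword-neg L (λ w → f (U ∷ w)) | Σword-neg L (λ w → f (D ∷ w)) =
  sym (neg-distrib-+ (Σword L (λ w → f (U ∷ w))) (Σword L (λ w → f (D ∷ w))))

Σword-*ˡ : ∀ L c (f : List Step → ℤ) → Σword L (λ w → c * f w) ≡ c * Σword L f
Σword-*ˡ zero    c f = refl
Σword-*ˡ (suc L) c f rewrite Σword-*ˡ L c (λ w → f (U ∷ w)) | Σword-*ˡ L c (λ w → f (D ∷ w)) =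
  sym (*-distribˡ-+ c (Σword L (λ w → f (U ∷ w))) (Σword L (λ w → f (D ∷ w))))

Σword-*ʳ : ∀ L c (f : List Step → ℤ) → Σword L (λ w → f w * c) ≡ Σword L f * c
Σword-*ʳ L c f = begin
  Σword L (λ w → f w * c)  ≡⟨ Σword-cong L (λ w → *-comm (f w) c) ⟩
  Σword L (λ w → c * f w)  ≡⟨ Σword-*ˡ L c f ⟩
  c * Σword L f            ≡⟨ *-comm c (Σword L f) ⟩
  Σword L f * c            ∎
  where open ≡-Reasoning

Σword-* : ∀ A B (f g : List Step → ℤ) → Σword A f * Σword B g ≡ Σword A (λ p → Σword B (λ q → f p * g q))
Σword-* A B f g = trans (sym (Σword-*ʳ A (Σword B g) f)) (Σword-cong A (λ p → sym (Σword-*ˡ B (f p) g)))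

Σ≤-Σword : ∀ n L (F : ℕ → List Step → ℤ) → Σ≤ n (λ i → Σword L (F i)) ≡ Σword L (λ w → Σ≤ n (λ i → F i w))
Σ≤-Σword zero    L F = refl
Σ≤-Σword (suc n) L F rewrite Σ≤-Σword n L F = sym (Σword-+ L (λ w → Σ≤ n (λ i → F i w)) (F (suc n)))

Σ≤-Σword² : ∀ n A B (F : ℕ → List Step → List Step → ℤ) →
  Σ≤ n (λ i → Σword A (λ p → Σword B (F i p))) ≡ Σword A (λ p → Σword B (λ q → Σ≤ n (λ i → F i p q)))
Σ≤-Σword² n A B F =
  trans (Σ≤-Σword n A (λ i p → Σword B (F i p))) (Σword-cong A (λ p → Σ≤-Σword n B (λ i → F i p)))

Σlist-words : ∀ L f → Σlist (words L) f ≡ Σword L f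
Σlist-words zero    f = +-identityʳ (f [])
Σlist-words (suc L) f = begin
  Σlist (concatMap branch (words L)) f              ≡⟨ Σlist-concatMap (words L) ⟩
  Σlist (words L) (λ w → f (U ∷ w) + f (D ∷ w))     ≡⟨ Σlist-words L _ ⟩
  Σword L (λ w → f (U ∷ w) + f (D ∷ w))             ≡⟨ Σword-+ L _ _ ⟩
  Σword (suc L) f                                   ∎
  where
  open ≡-Reasoning
  branch : List Step → List (List Step)
  branch w = (U ∷ w) ∷ (D ∷ w) ∷ []
  Σlist-concatMap : ∀ ws → Σlist (concatMap branch ws) f ≡ Σlist ws (λ w → f (U ∷ w) + f (D ∷ w))
  Σlist-concatMap []       = refl
  Σlist-concatMap (w ∷ ws) rewrite Σlist-concatMap ws = sym (+-assoc (f (U ∷ w)) (f (D ∷ w)) _)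

-- splits h v sums h p q over all factorisations v = p ++ D ∷ q.
splits : (List Step → List Step → ℤ) → List Step → ℤ
splits h []      = 0ℤ
splits h (U ∷ v) = splits (λ p q → h (U ∷ p) q) v
splits h (D ∷ v) = h [] v + splits (λ p q → h (D ∷ p) q) v

splits-zero : ∀ h v → (∀ p q → h p q ≡ 0ℤ) → splits h v ≡ 0ℤ
splits-zero h []      e = refl
splits-zero h (U ∷ v) e = splits-zero _ v (λ p q → e (U ∷ p) q)
splits-zero h (D ∷ v) e rewrite e [] v = trans (+-identityˡ _) (splits-zero _ v (λ p q → e (D ∷ p) q))

Σword-splits : ∀ L h → Σword (suc L) (splits h) ≡ Σ≤ L (λ i → Σword i (λ p → Σword (L ∸ i) (h p)))
Σword-splits zero    h = trans (+-identityˡ _) (+-identityʳ (h [] []))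
Σword-splits (suc L) h = begin
  Σword (suc L) (splits hU) + Σword (suc L) (λ v → h [] v + splits hD v)
    ≡⟨ cong₂ _+_ (Σword-splits L hU) (trans (Σword-+ (suc L) (h []) (splits hD))
                                            (cong (_+_ (Σword (suc L) (h []))) (Σword-splits L hD))) ⟩
  Σ≤ L (pairs hU) + (Σword (suc L) (h []) + Σ≤ L (pairs hD))
    ≡⟨ +-exchange (Σ≤ L (pairs hU)) (Σword (suc L) (h [])) (Σ≤ L (pairs hD)) ⟩
  Σword (suc L) (h []) + (Σ≤ L (pairs hU) + Σ≤ L (pairs hD))
    ≡⟨ cong (_+_ (Σword (suc L) (h []))) (sym (Σ≤-+ L (pairs hU) (pairs hD))) ⟩
  Σword (suc L) (h []) + Σ≤ L (λ i → pairs hU i + pairs hD i)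
    ≡⟨ sym (Σ≤-suc L (λ i → Σword i (λ p → Σword (suc L ∸ i) (h p)))) ⟩
  Σ≤ (suc L) (λ i → Σword i (λ p → Σword (suc L ∸ i) (h p)))
    ∎
  where
  open ≡-Reasoning
  hU hD : List Step → List Step → ℤ
  hU p = h (U ∷ p)
  hD p = h (D ∷ p)
  pairs : (List Step → List Step → ℤ) → ℕ → ℤ
  pairs g i = Σword i (λ p → Σword (L ∸ i) (g p))
  +-exchange : ∀ a b c → a + (b + c) ≡ b + (a + c)
  +-exchange = solve-∀

splits-firstReturn : ∀ a (g : List Step → List Step → ℤ) v →
  splits (λ p q → guard (dyckFrom a p) (guard (dyckFrom 0 q) (g p q))) v
    ≡ guard (dyckFrom (suc a) v) (g (proj₁ (firstReturn a v)) (proj₂ (firstReturn a v)))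
splits-firstReturn a       g []      = refl
splits-firstReturn a       g (U ∷ v) = splits-firstReturn (suc a) (λ p → g (U ∷ p)) v
splits-firstReturn zero    g (D ∷ v) =
  trans (cong (_+_ (guard (dyckFrom 0 v) (g [] v))) (splits-zero _ v (λ _ _ → refl)))
        (+-identityʳ (guard (dyckFrom 0 v) (g [] v)))
splits-firstReturn (suc a) g (D ∷ v) =
  trans (+-identityˡ _) (splits-firstReturn a (λ p → g (D ∷ p)) v)

guard-dyckFrom-odd : ∀ h w a x → length w ℕ.+ h ≡ suc (a ℕ.+ a) → guard (dyckFrom h w) x ≡ 0ℤ
guard-dyckFrom-odd h w a x odd with dyckFrom h w in eq
... | false = refl
... | true with dyckFrom-even h w (subst T (sym eq) _)
...   | d , even = ⊥-elim (double≢suc-double d a (trans (sym even) odd))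
  where
  double≢suc-double : ∀ d a → d ℕ.+ d ≢ suc (a ℕ.+ a)
  double≢suc-double (suc d) zero    e with trans (sym (ℕ.+-suc d d)) (ℕ.suc-injective e)
  ... | ()
  double≢suc-double (suc d) (suc a) e rewrite ℕ.+-suc d d | ℕ.+-suc a a =
    double≢suc-double d a (ℕ.suc-injective (ℕ.suc-injective e))

yz-coeff : ℕ → ℕ → ℕ → ℕ → ℤ
yz-coeff k m s t = ind (s ≡ᵇ k) * ind (t ≡ᵇ m)

yz-coeff-convolution : ∀ k m s t s′ t′ →
  Σ≤ k (λ b → Σ≤ m (λ c → yz-coeff b c s t * yz-coeff (k ∸ b) (m ∸ c) s′ t′))
    ≡ yz-coeff k m (s ℕ.+ s′) (t ℕ.+ t′)
yz-coeff-convolution k m s t s′ t′ = begin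
  Σ≤ k (λ b → Σ≤ m (λ c → yz-coeff b c s t * yz-coeff (k ∸ b) (m ∸ c) s′ t′))
    ≡⟨ Σ≤-cong k (λ b → Σ≤-cong m (λ c → regroup (δs b) (δt c) (δs′ (k ∸ b)) (δt′ (m ∸ c)))) ⟩
  Σ≤ k (λ b → Σ≤ m (λ c → δt c * (δt′ (m ∸ c) * (δs b * δs′ (k ∸ b)))))
    ≡⟨ Σ≤-cong k (λ b → trans (Σ≤-ind-convolution m t t′ (δs b * δs′ (k ∸ b)))
                              (regroup′ (ind (t ℕ.+ t′ ≡ᵇ m)) (δs b) (δs′ (k ∸ b)))) ⟩
  Σ≤ k (λ b → δs b * (δs′ (k ∸ b) * ind (t ℕ.+ t′ ≡ᵇ m)))
    ≡⟨ Σ≤-ind-convolution k s s′ (ind (t ℕ.+ t′ ≡ᵇ m)) ⟩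
  yz-coeff k m (s ℕ.+ s′) (t ℕ.+ t′)
    ∎
  where
  open ≡-Reasoning
  δs δt δs′ δt′ : ℕ → ℤ
  δs  b = ind (s ≡ᵇ b)
  δt  c = ind (t ≡ᵇ c)
  δs′ b = ind (s′ ≡ᵇ b)
  δt′ c = ind (t′ ≡ᵇ c)
  regroup : ∀ a b c d → a * b * (c * d) ≡ b * (d * (a * c))
  regroup = solve-∀
  regroup′ : ∀ e a c → e * (a * c) ≡ a * (c * e)
  regroup′ = solve-∀

W-Σword : ∀ n k m → W n k m ≡ Σword (n ℕ.+ n) (λ w → guard (dyckFrom 0 w) (yz-coeff k m (ud w) (uud w)))
W-Σword n k m = begin
  + length (filter counted (words (n ℕ.+ n)))                   ≡⟨ length-filter counted (words (n ℕ.+ n)) ⟩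
  Σlist (words (n ℕ.+ n)) (λ w → ind (does (counted w)))       ≡⟨ Σlist-words (n ℕ.+ n) _ ⟩
  Σword (n ℕ.+ n) (λ w → ind (does (counted w)))               ≡⟨ Σword-congL (n ℕ.+ n) summand ⟩
  Σword (n ℕ.+ n) (λ w → guard (dyckFrom 0 w) (yz-coeff k m (ud w) (uud w)))  ∎
  where
  open ≡-Reasoning
  counted : ∀ w → Dec (IsDyck n w × ud w ≡ k × uud w ≡ m)
  counted w = isDyck? n w ×-dec (ud w ℕ.≟ k) ×-dec (uud w ℕ.≟ m)
  summand : ∀ w → length w ≡ n ℕ.+ n →
    ind (does (counted w)) ≡ guard (dyckFrom 0 w) (yz-coeff k m (ud w) (uud w))
  summand w len rewrite isDyck?≡dyckFrom n w len = ind-∧ (dyckFrom 0 w) (ud w ≡ᵇ k) (uud w ≡ᵇ m)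

W-zero : ∀ k m → W 0 k m ≡ 𝟙 0 k m
W-zero zero    zero    = refl
W-zero zero    (suc m) = refl
W-zero (suc k) zero    = refl
W-zero (suc k) (suc m) = refl

∸-double : ∀ n a → (n ∸ a) ℕ.+ (n ∸ a) ≡ (n ℕ.+ n) ∸ (a ℕ.+ a)
∸-double zero    a       rewrite ℕ.0∸n≡0 a = sym (ℕ.0∸n≡0 (a ℕ.+ a))
∸-double (suc n) zero    = refl
∸-double (suc n) (suc a) rewrite ℕ.+-suc n n | ℕ.+-suc a a = ∸-double n a

-- The pairs (P , Q) of Dyck paths with |P| + |Q| = 2N, each encoded by the word v of length
-- 2N + 1 with U ∷ v = U P D Q the first return decomposition of a Dyck path of semilength N + 1.
atFirstReturn : (List Step → List Step → ℤ) → List Step → ℤ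
atFirstReturn F v = guard (dyckFrom 1 v) (uncurry F (firstReturn 0 v))

ΣDyckPairs : ℕ → (List Step → List Step → ℤ) → ℤ
ΣDyckPairs N F = Σword (suc (N ℕ.+ N)) (atFirstReturn F)

ΣDyckPairs-zero : ∀ N {F : List Step → List Step → ℤ} → (∀ P Q → F P Q ≡ 0ℤ) → ΣDyckPairs N F ≡ 0ℤ
ΣDyckPairs-zero N e = Σword-zero (suc (N ℕ.+ N)) λ v →
  trans (cong (guard (dyckFrom 1 v)) (e (proj₁ (firstReturn 0 v)) (proj₂ (firstReturn 0 v))))
        (guard-zero (dyckFrom 1 v))

ΣDyckPairs-+ : ∀ N (F G : List Step → List Step → ℤ) →
  ΣDyckPairs N (λ P Q → F P Q + G P Q) ≡ ΣDyckPairs N F + ΣDyckPairs N G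
ΣDyckPairs-+ N F G =
  trans (Σword-cong (suc (N ℕ.+ N)) λ v →
           guard-+ (dyckFrom 1 v) (uncurry F (firstReturn 0 v)) (uncurry G (firstReturn 0 v)))
        (Σword-+ (suc (N ℕ.+ N)) (atFirstReturn F) (atFirstReturn G))

ΣDyckPairs-neg : ∀ N (F : List Step → List Step → ℤ) → ΣDyckPairs N (λ P Q → - F P Q) ≡ - ΣDyckPairs N F
ΣDyckPairs-neg N F = trans (Σword-cong (suc (N ℕ.+ N)) (λ v → guard-neg (dyckFrom 1 v) (uncurry F (firstReturn 0 v))))
                           (Σword-neg (suc (N ℕ.+ N)) (atFirstReturn F))

ΣDyckPairs-combine : ∀ N F₁ F₂ F₃ G₁ G₂ G₃ →
  combine (ΣDyckPairs N F₁) (ΣDyckPairs N F₂) (ΣDyckPairs N F₃)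
          (ΣDyckPairs N G₁) (ΣDyckPairs N G₂) (ΣDyckPairs N G₃)
    ≡ ΣDyckPairs N (λ P Q → combine (F₁ P Q) (F₂ P Q) (F₃ P Q) (G₁ P Q) (G₂ P Q) (G₃ P Q))
ΣDyckPairs-combine N F₁ F₂ F₃ G₁ G₂ G₃ = sym (begin
  ΣDyckPairs N (λ P Q → F₁₂₃ P Q - G₁₂₃ P Q)
    ≡⟨ ΣDyckPairs-minus F₁₂₃ G₁₂₃ ⟩
  ΣDyckPairs N F₁₂₃ - ΣDyckPairs N G₁₂₃
    ≡⟨ cong₂ _-_ (trans (ΣDyckPairs-+ N F₁₂ F₃) (cong (_+ ΣDyckPairs N F₃) (ΣDyckPairs-minus F₁ F₂)))
                 (trans (ΣDyckPairs-minus G₁₂ G₃) (cong (_- ΣDyckPairs N G₃) (ΣDyckPairs-+ N G₁ G₂))) ⟩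
  combine (ΣDyckPairs N F₁) (ΣDyckPairs N F₂) (ΣDyckPairs N F₃)
          (ΣDyckPairs N G₁) (ΣDyckPairs N G₂) (ΣDyckPairs N G₃)
    ∎)
  where
  open ≡-Reasoning
  F₁₂ F₁₂₃ G₁₂ G₁₂₃ : List Step → List Step → ℤ
  F₁₂  P Q = F₁ P Q - F₂ P Q
  F₁₂₃ P Q = F₁₂ P Q + F₃ P Q
  G₁₂  P Q = G₁ P Q + G₂ P Q
  G₁₂₃ P Q = G₁₂ P Q - G₃ P Q
  ΣDyckPairs-minus : ∀ F G → ΣDyckPairs N (λ P Q → F P Q - G P Q) ≡ ΣDyckPairs N F - ΣDyckPairs N G
  ΣDyckPairs-minus F G = trans (ΣDyckPairs-+ N F (λ P Q → - G P Q)) (cong (_+_ (ΣDyckPairs N F)) (ΣDyckPairs-neg N G))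

ΣDyckPairs-null : ∀ N (F : List Step → List Step → ℤ) →
  ΣDyckPairs N (λ P Q → guard (null P) (F P Q)) ≡ Σword (N ℕ.+ N) (λ Q → guard (dyckFrom 0 Q) (F [] Q))
ΣDyckPairs-null N F = trans (cong (_+ Σword (N ℕ.+ N) (λ Q → guard (dyckFrom 0 Q) (F [] Q)))
                                  (Σword-zero (N ℕ.+ N) (λ v → guard-zero (dyckFrom 2 v))))
                            (+-identityˡ _)

ΣDyckPairs-startsWithPeak : ∀ N (F : List Step → List Step → ℤ) →
  ΣDyckPairs (suc N) (λ P Q → guard (startsWithPeak P) (F P Q)) ≡ ΣDyckPairs N (λ P Q → F (U ∷ D ∷ P) Q)
ΣDyckPairs-startsWithPeak N F = begin
  ΣDyckPairs (suc N) (λ P Q → guard (startsWithPeak P) (F P Q))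
    ≡⟨ cong (λ L → Σword (suc (suc L)) summand) (ℕ.+-suc N N) ⟩
  (Σword (suc (N ℕ.+ N)) (λ v → summand (U ∷ U ∷ v)) + ΣDyckPairs N (λ P Q → F (U ∷ D ∷ P) Q))
    + Σword (suc (suc (N ℕ.+ N))) (λ v → summand (D ∷ v))
    ≡⟨ cong₂ (λ x y → x + ΣDyckPairs N (λ P Q → F (U ∷ D ∷ P) Q) + y)
             (Σword-zero (suc (N ℕ.+ N)) (λ v → guard-zero (dyckFrom 3 v)))
             (Σword-zero (suc (suc (N ℕ.+ N))) (λ v → guard-zero (dyckFrom 0 v))) ⟩
  0ℤ + ΣDyckPairs N (λ P Q → F (U ∷ D ∷ P) Q) + 0ℤ
    ≡⟨ trans (+-identityʳ _) (+-identityˡ _) ⟩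
  ΣDyckPairs N (λ P Q → F (U ∷ D ∷ P) Q)
    ∎
  where
  open ≡-Reasoning
  summand : List Step → ℤ
  summand = atFirstReturn (λ P Q → guard (startsWithPeak P) (F P Q))

-- Both factors count Dyck paths, so the terms with |P| odd vanish and the convolution in x becomes
-- a sum over the splittings of the words of length 2N + 1, which are then read as first returns.
W⊛W-ΣDyckPairs : ∀ N k m → (W ⊛ W) N k m ≡ ΣDyckPairs N (λ P Q → yz-coeff k m (ud₂ P Q) (uud₂ P Q))
W⊛W-ΣDyckPairs N k m = begin
  Σ³ N k m (λ a b c → W a b c * W (N ∸ a) (k ∸ b) (m ∸ c))
    ≡⟨ Σ³-cong N k m (λ a b c → trans (cong₂ _*_ (W-Σword a b c) (W-Σword (N ∸ a) (k ∸ b) (m ∸ c)))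
                                      (Σword-* (a ℕ.+ a) (L a) (path b c) (path (k ∸ b) (m ∸ c)))) ⟩
  Σ³ N k m (λ a b c → Σword (a ℕ.+ a) (λ p → Σword (L a) (pathPair b c p)))
    ≡⟨ Σ≤-cong N (λ a → trans (Σ≤-cong k (λ b → Σ≤-Σword² m (a ℕ.+ a) (L a) (pathPair b)))
                              (Σ≤-Σword² k (a ℕ.+ a) (L a) (λ b p q → Σ≤ m (λ c → pathPair b c p q)))) ⟩
  Σ≤ N (λ a → Σword (a ℕ.+ a) (λ p → Σword (L a) (λ q → Σ≤ k (λ b → Σ≤ m (λ c → pathPair b c p q)))))
    ≡⟨ Σ≤-cong N (λ a → Σword-cong (a ℕ.+ a) (λ p → Σword-cong (L a) (convolve p))) ⟩
  Σ≤ N (λ a → Σword (a ℕ.+ a) (λ p → Σword (L a) (dyckPair p)))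
    ≡⟨ Σ≤-cong N (λ a → cong (λ l → Σword (a ℕ.+ a) (λ p → Σword l (dyckPair p))) (∸-double N a)) ⟩
  Σ≤ N (λ a → Σword (a ℕ.+ a) (λ p → Σword ((N ℕ.+ N) ∸ (a ℕ.+ a)) (dyckPair p)))
    ≡⟨ sym (Σ≤-even N (λ i → Σword i (λ p → Σword ((N ℕ.+ N) ∸ i) (dyckPair p))) oddVanishes) ⟩
  Σ≤ (N ℕ.+ N) (λ i → Σword i (λ p → Σword ((N ℕ.+ N) ∸ i) (dyckPair p)))
    ≡⟨ sym (Σword-splits (N ℕ.+ N) dyckPair) ⟩
  Σword (suc (N ℕ.+ N)) (splits dyckPair)
    ≡⟨ Σword-cong (suc (N ℕ.+ N)) (splits-firstReturn 0 (λ p q → yz-coeff k m (ud₂ p q) (uud₂ p q))) ⟩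
  ΣDyckPairs N (λ P Q → yz-coeff k m (ud₂ P Q) (uud₂ P Q))
    ∎
  where
  open ≡-Reasoning
  L : ℕ → ℕ
  L a = (N ∸ a) ℕ.+ (N ∸ a)
  path : ℕ → ℕ → List Step → ℤ
  path b c p = guard (dyckFrom 0 p) (yz-coeff b c (ud p) (uud p))
  pathPair : ℕ → ℕ → List Step → List Step → ℤ
  pathPair b c p q = path b c p * path (k ∸ b) (m ∸ c) q
  dyckPair : List Step → List Step → ℤ
  dyckPair p q = guard (dyckFrom 0 p) (guard (dyckFrom 0 q) (yz-coeff k m (ud₂ p q) (uud₂ p q)))
  convolve : ∀ p q → Σ≤ k (λ b → Σ≤ m (λ c → pathPair b c p q)) ≡ dyckPair p q
  convolve p q = begin
    Σ≤ k (λ b → Σ≤ m (λ c → pathPair b c p q))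
      ≡⟨ Σ≤-cong k (λ b → Σ≤-cong m (λ c →
           guard-* dp dq (yz-coeff b c (ud p) (uud p)) (yz-coeff (k ∸ b) (m ∸ c) (ud q) (uud q)))) ⟩
    Σ≤ k (λ b → Σ≤ m (λ c → guard dp (guard dq (coeffs b c))))
      ≡⟨ Σ≤-cong k (λ b → trans (Σ≤-guard m dp _) (cong (guard dp) (Σ≤-guard m dq (coeffs b)))) ⟩
    Σ≤ k (λ b → guard dp (guard dq (Σ≤ m (coeffs b))))
      ≡⟨ trans (Σ≤-guard k dp _) (cong (guard dp) (Σ≤-guard k dq (λ b → Σ≤ m (coeffs b)))) ⟩
    guard dp (guard dq (Σ≤ k (λ b → Σ≤ m (coeffs b))))
      ≡⟨ cong (λ x → guard dp (guard dq x)) (yz-coeff-convolution k m (ud p) (uud p) (ud q) (uud q)) ⟩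
    dyckPair p q
      ∎
    where
    dp dq : Bool
    dp = dyckFrom 0 p
    dq = dyckFrom 0 q
    coeffs : ℕ → ℕ → ℤ
    coeffs b c = yz-coeff b c (ud p) (uud p) * yz-coeff (k ∸ b) (m ∸ c) (ud q) (uud q)
  oddVanishes : ∀ a → Σword (suc (a ℕ.+ a)) (λ p → Σword ((N ℕ.+ N) ∸ suc (a ℕ.+ a)) (dyckPair p)) ≡ 0ℤ
  oddVanishes a = trans
    (Σword-congL (suc (a ℕ.+ a)) {g = λ _ → 0ℤ} λ p len → Σword-zero ((N ℕ.+ N) ∸ suc (a ℕ.+ a)) λ q →
      guard-dyckFrom-odd 0 p a (guard (dyckFrom 0 q) (yz-coeff k m (ud₂ p q) (uud₂ p q)))
                         (trans (ℕ.+-identityʳ (length p)) len))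
    (Σword-zero (suc (a ℕ.+ a)) (λ _ → refl))

x-W²-ΣDyckPairs : ∀ N k m → (mono 1 0 0 ⊛ (W ⊛ W)) (suc N) k m ≡
  ΣDyckPairs N (λ P Q → yz-coeff k m (ud₂ P Q) (uud₂ P Q))
x-W²-ΣDyckPairs N k m = trans (mono-⊛ 1 0 0 (W ⊛ W) (suc N) k m) (W⊛W-ΣDyckPairs N k m)

x²y-W²-ΣDyckPairs : ∀ N k m → (mono 2 1 0 ⊛ (W ⊛ W)) (suc N) k m ≡
  ΣDyckPairs N (λ P Q → guard (startsWithPeak P) (yz-coeff k m (ud₂ P Q) (uud₂ P Q)))
x²y-W²-ΣDyckPairs N k m = trans (mono-⊛ 2 1 0 (W ⊛ W) (suc N) k m) (peaks N k)
  where
  peaks : ∀ N k → shift 1 (λ i → shift 1 (λ j → (W ⊛ W) i j m) k) N ≡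
    ΣDyckPairs N (λ P Q → guard (startsWithPeak P) (yz-coeff k m (ud₂ P Q) (uud₂ P Q)))
  peaks zero    k       = refl
  peaks (suc N) k       = trans (shifted k) (sym (ΣDyckPairs-startsWithPeak N (summand k)))
    where
    summand : ℕ → List Step → List Step → ℤ
    summand k P Q = yz-coeff k m (ud₂ P Q) (uud₂ P Q)
    shifted : ∀ k → shift 1 (λ j → (W ⊛ W) N j m) k ≡ ΣDyckPairs N (λ P Q → summand k (U ∷ D ∷ P) Q)
    shifted zero    = sym (ΣDyckPairs-zero N (λ _ _ → refl))
    shifted (suc k) = W⊛W-ΣDyckPairs N k m

x²yz-W²-ΣDyckPairs : ∀ N k m → (mono 2 1 1 ⊛ (W ⊛ W)) (suc N) k m ≡
  ΣDyckPairs N (λ P Q → guard (startsWithPeak P) (yz-coeff k m (ud₂ P Q) (suc (uud₂ P Q))))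
x²yz-W²-ΣDyckPairs N k m = trans (mono-⊛ 2 1 1 (W ⊛ W) (suc N) k m) (peaks N k m)
  where
  peaks : ∀ N k m → shift 1 (λ i → shift 1 (λ j → shift 1 ((W ⊛ W) i j) m) k) N ≡
    ΣDyckPairs N (λ P Q → guard (startsWithPeak P) (yz-coeff k m (ud₂ P Q) (suc (uud₂ P Q))))
  peaks zero    k       m       = refl
  peaks (suc N) k       m       = trans (shifted k m) (sym (ΣDyckPairs-startsWithPeak N (summand k m)))
    where
    summand : ℕ → ℕ → List Step → List Step → ℤ
    summand k m P Q = yz-coeff k m (ud₂ P Q) (suc (uud₂ P Q))
    shifted : ∀ k m → shift 1 (λ j → shift 1 ((W ⊛ W) N j) m) k ≡
      ΣDyckPairs N (λ P Q → summand k m (U ∷ D ∷ P) Q)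
    shifted zero    m       = sym (ΣDyckPairs-zero N (λ _ _ → refl))
    shifted (suc k) zero    = sym (ΣDyckPairs-zero N (λ P Q → *-zeroʳ (ind (suc (ud₂ P Q) ℕ.≡ᵇ suc k))))
    shifted (suc k) (suc m) = W⊛W-ΣDyckPairs N k m

W-ΣDyckPairs : ∀ N k m → (𝟙 ⊛ W) (suc N) k m ≡
  ΣDyckPairs N (λ P Q → yz-coeff k m (χ (null P) ℕ.+ ud₂ P Q) (χ (startsWithPeak P) ℕ.+ uud₂ P Q))
W-ΣDyckPairs N k m = begin
  (𝟙 ⊛ W) (suc N) k m
    ≡⟨ mono-⊛ 0 0 0 W (suc N) k m ⟩
  W (suc N) k m
    ≡⟨ W-Σword (suc N) k m ⟩
  Σword (suc N ℕ.+ suc N) paths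
    ≡⟨ cong (λ L → Σword (suc L) paths) (ℕ.+-suc N N) ⟩
  Σword (suc (N ℕ.+ N)) (λ v → paths (U ∷ v)) + Σword (suc (N ℕ.+ N)) (λ v → paths (D ∷ v))
    ≡⟨ cong₂ _+_ (Σword-cong (suc (N ℕ.+ N)) decompose) (Σword-zero (suc (N ℕ.+ N)) (λ _ → refl)) ⟩
  ΣDyckPairs N firstReturnWeight + 0ℤ
    ≡⟨ +-identityʳ _ ⟩
  ΣDyckPairs N firstReturnWeight
    ∎
  where
  open ≡-Reasoning
  paths : List Step → ℤ
  paths w = guard (dyckFrom 0 w) (yz-coeff k m (ud w) (uud w))
  firstReturnWeight : List Step → List Step → ℤ
  firstReturnWeight P Q = yz-coeff k m (χ (null P) ℕ.+ ud₂ P Q) (χ (startsWithPeak P) ℕ.+ uud₂ P Q)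
  decompose : ∀ v → paths (U ∷ v) ≡ atFirstReturn firstReturnWeight v
  decompose v with dyckFrom 1 v in eq
  ... | false = refl
  ... | true  = cong₂ (yz-coeff k m) (trans (cong (λ w → ud (U ∷ w)) split) (ud-firstReturn P Q dyckP))
                                      (trans (cong (λ w → uud (U ∷ w)) split) (uud-firstReturn P Q dyckP))
    where
    P = proj₁ (firstReturn 0 v)
    Q = proj₂ (firstReturn 0 v)
    dyck : T (dyckFrom 1 v)
    dyck = subst T (sym eq) _
    split : v ≡ P ++ D ∷ Q
    split = firstReturn-++ 0 v dyck
    dyckP : T (dyckFrom 0 P)
    dyckP = firstReturn-dyckFrom 0 v dyck

x-W-ΣDyckPairs : ∀ N k m → (mono 1 0 0 ⊛ W) (suc N) k m ≡
  ΣDyckPairs N (λ P Q → guard (null P) (yz-coeff k m (ud₂ P Q) (uud₂ P Q)))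
x-W-ΣDyckPairs N k m = trans (mono-⊛ 1 0 0 W (suc N) k m) (trans (W-Σword N k m)
  (sym (ΣDyckPairs-null N (λ P Q → yz-coeff k m (ud₂ P Q) (uud₂ P Q)))))

xy-W-ΣDyckPairs : ∀ N k m → (mono 1 1 0 ⊛ W) (suc N) k m ≡
  ΣDyckPairs N (λ P Q → guard (null P) (yz-coeff k m (suc (ud₂ P Q)) (uud₂ P Q)))
xy-W-ΣDyckPairs N k m = trans (mono-⊛ 1 1 0 W (suc N) k m) (trans (empties k)
  (sym (ΣDyckPairs-null N (λ P Q → yz-coeff k m (suc (ud₂ P Q)) (uud₂ P Q)))))
  where
  empties : ∀ k → shift 1 (λ j → W N j m) k ≡
    Σword (N ℕ.+ N) (λ Q → guard (dyckFrom 0 Q) (yz-coeff k m (suc (ud Q)) (uud Q)))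
  empties zero    = sym (Σword-zero (N ℕ.+ N) (λ Q → guard-zero (dyckFrom 0 Q)))
  empties (suc k) = W-Σword N k m

combine-cancels : ∀ (f : ℕ → ℕ → ℤ) e p s t → T (not (e ∧ p)) →
  combine (f s t) (guard p (f s t)) (guard p (f s (suc t)))
          (f (χ e ℕ.+ s) (χ p ℕ.+ t)) (guard e (f s t)) (guard e (f (suc s) t))
    ≡ 0ℤ
combine-cancels f false false s t _ = neither (f s t)
  where
  neither : ∀ a → a - 0ℤ + 0ℤ - (a + 0ℤ - 0ℤ) ≡ 0ℤ
  neither = solve-∀
combine-cancels f true  false s t _ = empty (f s t) (f (suc s) t)
  where
  empty : ∀ a b → a - 0ℤ + 0ℤ - (b + a - b) ≡ 0ℤ
  empty = solve-∀
combine-cancels f false true  s t _ = peak (f s t) (f s (suc t))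
  where
  peak : ∀ a b → a - a + b - (b + 0ℤ - 0ℤ) ≡ 0ℤ
  peak = solve-∀

lemma2p1 : ∀ n k m →
    ((mono 1 0 0 ⊖ mono 2 1 0 ⊕ mono 2 1 1) ⊛ (W ⊛ W)
      ⊖ (𝟙 ⊕ mono 1 0 0 ⊖ mono 1 1 0) ⊛ W ⊕ 𝟙) n k m ≡ 𝟘 n k m
lemma2p1 zero    k m = begin
  _ ≡⟨ expand (W ⊛ W) W 0 k m ⟩
  _ ≡⟨ cong (_+ 𝟙 0 k m) (combine-cong (mono-⊛ 1 0 0 (W ⊛ W) 0 k m) (mono-⊛ 2 1 0 (W ⊛ W) 0 k m)
                                       (mono-⊛ 2 1 1 (W ⊛ W) 0 k m) (trans (mono-⊛ 0 0 0 W 0 k m) (W-zero k m))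
                                       (mono-⊛ 1 0 0 W 0 k m) (mono-⊛ 1 1 0 W 0 k m)) ⟩
  combine 0ℤ 0ℤ 0ℤ (𝟙 0 k m) 0ℤ 0ℤ + 𝟙 0 k m ≡⟨ constant (𝟙 0 k m) ⟩
  0ℤ ∎
  where
  open ≡-Reasoning
  constant : ∀ a → 0ℤ - 0ℤ + 0ℤ - (a + 0ℤ - 0ℤ) + a ≡ 0ℤ
  constant = solve-∀
lemma2p1 (suc N) k m = begin
  _ ≡⟨ expand (W ⊛ W) W (suc N) k m ⟩
  _ ≡⟨ +-identityʳ _ ⟩
  _ ≡⟨ combine-cong (x-W²-ΣDyckPairs N k m) (x²y-W²-ΣDyckPairs N k m) (x²yz-W²-ΣDyckPairs N k m)
                    (W-ΣDyckPairs N k m) (x-W-ΣDyckPairs N k m) (xy-W-ΣDyckPairs N k m) ⟩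
  _ ≡⟨ ΣDyckPairs-combine N xW² x²yW² x²yzW² 𝟙W xW xyW ⟩
  _ ≡⟨ ΣDyckPairs-zero N (λ P Q → combine-cancels (yz-coeff k m) (null P) (startsWithPeak P)
                                                     (ud₂ P Q) (uud₂ P Q) (¬null∧startsWithPeak P)) ⟩
  0ℤ ∎
  where
  open ≡-Reasoning
  xW² x²yW² x²yzW² 𝟙W xW xyW : List Step → List Step → ℤ
  xW²    P Q = yz-coeff k m (ud₂ P Q) (uud₂ P Q)
  x²yW²  P Q = guard (startsWithPeak P) (yz-coeff k m (ud₂ P Q) (uud₂ P Q))
  x²yzW² P Q = guard (startsWithPeak P) (yz-coeff k m (ud₂ P Q) (suc (uud₂ P Q)))
  𝟙W     P Q = yz-coeff k m (χ (null P) ℕ.+ ud₂ P Q) (χ (startsWithPeak P) ℕ.+ uud₂ P Q)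
  xW     P Q = guard (null P) (yz-coeff k m (ud₂ P Q) (uud₂ P Q))
  xyW    P Q = guard (null P) (yz-coeff k m (suc (ud₂ P Q)) (uud₂ P Q))
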